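{- Let $E$ be an edifice and let $\sigma,\sigma'$ be feedback functions with disjoint domains. Then $\mathrm{Tr}_\sigma(\mathrm{Tr}_{\sigma'}(E))=\mathrm{Tr}_{\sigma\uplus\sigma'}(E)$.
   Context: $\mathcal C=\{\mathsf p,\mathsf q\}^{\mathbb N}$. A pillar is $(u,i)$ with $u\in\mathcal C\times\mathcal C$, $i\in\mathbb N$. An arch is an unordered pair of pillars; an edifice is a set of arches. A feedback function is a fixpoint-free partial involution $\sigma$ on $\mathbb N$ with finite domain; for $\sigma,\sigma'$ with disjoint domains, $\sigma\uplus\sigma'$ is the feedback function agreeing with $\sigma$ on $\mathrm{dom}\,\sigma$, with $\sigma'$ on $\mathrm{dom}\,\sigma'$, and undefined elsewhere. A trace sequence of $E$ along $\sigma$ is a non-empty finite sequence of arches of $E$, each written with a chosen order of its pillars as $\{(u_k,i_k),(v_k,j_k)\}$, $1\le k\le n$, with $j_{k-1}\in\mathrm{dom}\,\sigma$, $i_k=\sigma(j_{k-1})$ and $u_k=v_{k-1}$ for $2\le k\le n$; it is visible if $i_1,j_n\notin\mathrm{dom}\,\sigma$. $\mathrm{Tr}_\sigma(E)$ is the set of arches $\{(u_1,i_1),(v_n,j_n)\}$ over visible trace sequences of $E$ along $\sigma$. -}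

module Defs where

open import Data.Nat using (ℕ; _≤_)
open import Data.Maybe using (Maybe; just; nothing)
open import Data.Product using (Σ; ∃; _×_; _,_; proj₁; proj₂)
open import Data.Sum using (_⊎_)
open import Data.List using (List; []; _∷_)
open import Data.Unit using (⊤)
open import Relation.Binary.PropositionalEquality using (_≡_; _≢_)

data Letter : Set where
  𝗉 𝗊 : Letter

𝒞 : Set
𝒞 = ℕ → Letter

Pillar : Set
Pillar = (𝒞 × 𝒞) × ℕ

idx : Pillar → ℕ
idx = proj₂

addr : Pillar → 𝒞 × 𝒞
addr = proj₁

-- An edifice (a set of arches = unordered pairs of pillars) is represented
-- by a relation on pillars; the arch {a , b} belongs to E iff E a b or E b a.
Edifice : Set₁
Edifice = Pillar → Pillar → Set

ArchIn : Edifice → Pillar → Pillar → Set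
ArchIn E a b = E a b ⊎ E b a

PFun : Set
PFun = ℕ → Maybe ℕ

record Feedback : Set where
  field
    fn      : PFun
    invol   : ∀ i j → fn i ≡ just j → fn j ≡ just i
    fpfree  : ∀ i → fn i ≢ just i
    finite  : Σ ℕ λ N → ∀ i → N ≤ i → fn i ≡ nothing
open Feedback public

DisjointDom : Feedback → Feedback → Set
DisjointDom σ σ' = ∀ i → fn σ i ≡ nothing ⊎ fn σ' i ≡ nothing

_⊎ᶠ_ : PFun → PFun → PFun
(f ⊎ᶠ g) i with f i
... | just j  = just j
... | nothing = g i

OArch : Set
OArch = Pillar × Pillar

Link : PFun → OArch → OArch → Set
Link σ (_ , (v , j)) ((u , i) , _) = (σ j ≡ just i) × (u ≡ v)

Steps : PFun → Edifice → OArch → List OArch → Set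
Steps σ E x []       = ⊤
Steps σ E x (y ∷ ys) = Link σ x y × ArchIn E (proj₁ y) (proj₂ y) × Steps σ E y ys

lastA : OArch → List OArch → OArch
lastA x []       = x
lastA x (y ∷ ys) = lastA y ys

record VisibleTrace (σ : PFun) (E : Edifice) (a b : Pillar) : Set where
  field
    first   : OArch
    rest    : List OArch
    firstIn : ArchIn E (proj₁ first) (proj₂ first)
    steps   : Steps σ E first rest
    start   : proj₁ first ≡ a
    end     : proj₂ (lastA first rest) ≡ b
    visIn   : σ (idx a) ≡ nothing
    visOut  : σ (idx b) ≡ nothing

Tr : PFun → Edifice → Edifice
Tr σ E a b = VisibleTrace σ E a b

_≐_ : Edifice → Edifice → Set
E ≐ F = ∀ a b → (ArchIn E a b → ArchIn F a b) × (ArchIn F a b → ArchIn E a b)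

-- A visible trace along σ ⊎ σ' is a chain of arches of E whose joints are links of
-- σ or of σ'. Its maximal σ'-linked stretches are exactly the visible σ'-traces, i.e. the
-- arches of Tr σ' E, and these stretches are joined by σ-links; so the trace is a
-- visible σ-trace of Tr σ' E. Conversely such a trace expands into one along σ ⊎ σ' by
-- replacing each of its arches by the σ'-trace it comes from, reversed if needed.
-- Disjointness of the domains is what makes the two kinds of joints distinguishable.
module Submission where

open import Defs
open import Data.Nat using (ℕ)
open import Data.Maybe using (just; nothing)
open import Data.Product using (Σ; _×_; _,_; proj₁; proj₂; map₁)
open import Data.Sum using (_⊎_; inj₁; inj₂; swap) renaming (map to map-⊎)
open import Data.List using (List; []; _∷_)
open import Data.Unit using (tt)
open import Relation.Binary.PropositionalEquality using (_≡_; refl; sym; trans)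

Linked : PFun → Pillar → Pillar → Set
Linked f b c = (f (idx b) ≡ just (idx c)) × (addr c ≡ addr b)

data Chain (f : PFun) (E : Edifice) : Pillar → Pillar → Set where
  [_]    : ∀ {a b} → ArchIn E a b → Chain f E a b
  _∷⟨_⟩_ : ∀ {a b c d} → ArchIn E a b → Linked f b c → Chain f E c d → Chain f E a d

module _ {f : PFun} {E : Edifice} where

  _++⟨_⟩_ : ∀ {a b c d} → Chain f E a b → Linked f b c → Chain f E c d → Chain f E a d
  [ e ]          ++⟨ l ⟩ c = e ∷⟨ l ⟩ c
  (e ∷⟨ l' ⟩ c') ++⟨ l ⟩ c = e ∷⟨ l' ⟩ (c' ++⟨ l ⟩ c)

  steps⇒chain : (x : OArch) (xs : List OArch) → ArchIn E (proj₁ x) (proj₂ x) →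
    Steps f E x xs → Chain f E (proj₁ x) (proj₂ (lastA x xs))
  steps⇒chain x []       e _              = [ e ]
  steps⇒chain x (y ∷ ys) e (l , e' , st) = e ∷⟨ l ⟩ steps⇒chain y ys e' st

  record TraceSequence (a b : Pillar) : Set where
    field
      first   : OArch
      rest    : List OArch
      firstIn : ArchIn E (proj₁ first) (proj₂ first)
      steps   : Steps f E first rest
      start   : proj₁ first ≡ a
      end     : proj₂ (lastA first rest) ≡ b

  chain⇒traceSequence : ∀ {a b} → Chain f E a b → TraceSequence a b
  chain⇒traceSequence {a} {b} [ e ] = record
    { first = a , b ; rest = [] ; firstIn = e ; steps = tt ; start = refl ; end = refl }
  chain⇒traceSequence {a} (_∷⟨_⟩_ {b = m} e l c) with chain⇒traceSequence c
  ... | record { first = x ; rest = xs ; firstIn = x∈E ; steps = st ; start = refl ; end = x⋯b } =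
    record { first = a , m ; rest = x ∷ xs ; firstIn = e ; steps = l , x∈E , st
           ; start = refl ; end = x⋯b }

  visibleTrace⇒chain : ∀ {a b} → VisibleTrace f E a b → Chain f E a b
  visibleTrace⇒chain record { first = x ; rest = xs ; firstIn = e ; steps = st
                            ; start = refl ; end = refl } =
    steps⇒chain x xs e st

  chain⇒visibleTrace : ∀ {a b} → Chain f E a b →
    f (idx a) ≡ nothing → f (idx b) ≡ nothing → VisibleTrace f E a b
  chain⇒visibleTrace c va vb = record
    { first = first ; rest = rest ; firstIn = firstIn ; steps = steps
    ; start = start ; end = end ; visIn = va ; visOut = vb }
    where open TraceSequence (chain⇒traceSequence c)

map-links : ∀ {f g E a b} → (∀ {x y} → Linked f x y → Linked g x y) →
  Chain f E a b → Chain g E a b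
map-links φ [ e ]          = [ e ]
map-links φ (e ∷⟨ l ⟩ c) = e ∷⟨ φ l ⟩ map-links φ c

Linked-sym : (F : Feedback) → ∀ {b c} → Linked (fn F) b c → Linked (fn F) c b
Linked-sym F (l , u) = invol F _ _ l , sym u

reverse : (F : Feedback) → ∀ {E a b} → Chain (fn F) E a b → Chain (fn F) E b a
reverse F [ e ]          = [ swap e ]
reverse F (e ∷⟨ l ⟩ c) = reverse F c ++⟨ Linked-sym F l ⟩ [ swap e ]

traceArch⇒chain : (F : Feedback) → ∀ {E a b} → ArchIn (Tr (fn F) E) a b → Chain (fn F) E a b
traceArch⇒chain F (inj₁ t) = visibleTrace⇒chain t
traceArch⇒chain F (inj₂ t) = reverse F (visibleTrace⇒chain t)

start-undefined : ∀ {f g E a b} → Chain g (Tr f E) a b → f (idx a) ≡ nothing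
start-undefined [ inj₁ t ]     = VisibleTrace.visIn t
start-undefined [ inj₂ t ]     = VisibleTrace.visOut t
start-undefined (inj₁ t ∷⟨ _ ⟩ _) = VisibleTrace.visIn t
start-undefined (inj₂ t ∷⟨ _ ⟩ _) = VisibleTrace.visOut t

end-undefined : (G : Feedback) → ∀ {f E a b} → Chain (fn G) (Tr f E) a b → f (idx b) ≡ nothing
end-undefined G c = start-undefined (reverse G c)

module ⊎ᶠ-Properties (f g : PFun) {i : ℕ} where

  ⊎ᶠ-just : ∀ {j} → f i ≡ just j → (f ⊎ᶠ g) i ≡ just j
  ⊎ᶠ-just eq with f i
  ⊎ᶠ-just refl | just _ = refl

  ⊎ᶠ-nothing : f i ≡ nothing → (f ⊎ᶠ g) i ≡ g i
  ⊎ᶠ-nothing eq with f i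
  ⊎ᶠ-nothing refl | nothing = refl

  ⊎ᶠ-undefined : f i ≡ nothing → g i ≡ nothing → (f ⊎ᶠ g) i ≡ nothing
  ⊎ᶠ-undefined p q = trans (⊎ᶠ-nothing p) q

  ⊎ᶠ-undefined⁻ : (f ⊎ᶠ g) i ≡ nothing → f i ≡ nothing × g i ≡ nothing
  ⊎ᶠ-undefined⁻ eq with f i
  ⊎ᶠ-undefined⁻ () | just _
  ⊎ᶠ-undefined⁻ eq | nothing = refl , eq

  ⊎ᶠ-just⁻ : ∀ {j} → (f ⊎ᶠ g) i ≡ just j → f i ≡ just j ⊎ (f i ≡ nothing × g i ≡ just j)
  ⊎ᶠ-just⁻ eq with f i
  ⊎ᶠ-just⁻ eq | just _  = inj₁ eq
  ⊎ᶠ-just⁻ eq | nothing = inj₂ (refl , eq)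

module Disjoint {σ σ' : Feedback} (disjoint : DisjointDom σ σ') {i j : ℕ} where

  left-defined⇒right-undefined : fn σ i ≡ just j → fn σ' i ≡ nothing
  left-defined⇒right-undefined eq with disjoint i
  ... | inj₂ undef = undef
  ... | inj₁ undef with () ← trans (sym eq) undef

  right-defined⇒left-undefined : fn σ' i ≡ just j → fn σ i ≡ nothing
  right-defined⇒left-undefined eq with disjoint i
  ... | inj₁ undef = undef
  ... | inj₂ undef with () ← trans (sym eq) undef

module Composition (E : Edifice) (σ σ' : Feedback) (disjoint : DisjointDom σ σ') where

  open ⊎ᶠ-Properties (fn σ) (fn σ')
  open Disjoint {σ} {σ'} disjoint

  τ : PFun
  τ = fn σ ⊎ᶠ fn σ'

  σ-link⇒τ-link : ∀ {b c} → Linked (fn σ) b c → Linked τ b c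
  σ-link⇒τ-link = map₁ ⊎ᶠ-just

  σ'-link⇒τ-link : ∀ {b c} → Linked (fn σ') b c → Linked τ b c
  σ'-link⇒τ-link = map₁ λ l → trans (⊎ᶠ-nothing (right-defined⇒left-undefined l)) l

  flatten : ∀ {a b} → Chain (fn σ) (Tr (fn σ') E) a b → Chain τ E a b
  flatten [ t ]          = map-links σ'-link⇒τ-link (traceArch⇒chain σ' t)
  flatten (t ∷⟨ l ⟩ c) =
    map-links σ'-link⇒τ-link (traceArch⇒chain σ' t) ++⟨ σ-link⇒τ-link l ⟩ flatten c

  -- A τ-chain split at its first σ-link: the σ'-chain before it, and what follows.
  record FirstSegment (a b : Pillar) : Set where
    field
      {exit}       : Pillar
      segment      : Chain (fn σ') E a exit
      exitVisible  : fn σ' (idx exit) ≡ nothing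
      continuation : exit ≡ b ⊎ Σ Pillar λ n → Linked (fn σ) exit n × Chain (fn σ) (Tr (fn σ') E) n b

  close : ∀ {a b} → FirstSegment a b → fn σ' (idx a) ≡ nothing → Chain (fn σ) (Tr (fn σ') E) a b
  close record { segment = s ; exitVisible = vx ; continuation = inj₁ refl } va =
    [ inj₁ (chain⇒visibleTrace s va vx) ]
  close record { segment = s ; exitVisible = vx ; continuation = inj₂ (_ , l , c) } va =
    inj₁ (chain⇒visibleTrace s va vx) ∷⟨ l ⟩ c

  expand : ∀ {a b} → Chain τ E a b → τ (idx b) ≡ nothing → FirstSegment a b
  expand [ e ] vb = record
    { segment = [ e ] ; exitVisible = proj₂ (⊎ᶠ-undefined⁻ vb) ; continuation = inj₁ refl }
  expand (e ∷⟨ l , u ⟩ c) vb with ⊎ᶠ-just⁻ l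
  ... | inj₁ σl = record
    { segment      = [ e ]
    ; exitVisible  = left-defined⇒right-undefined σl
    ; continuation = inj₂ (_ , (σl , u) , close (expand c vb)
                                                (left-defined⇒right-undefined (invol σ _ _ σl))) }
  ... | inj₂ (_ , σ'l) = record
    { segment = e ∷⟨ σ'l , u ⟩ segment ; exitVisible = exitVisible ; continuation = continuation }
    where open FirstSegment (expand c vb)

  Tr-compose⇒ : ∀ {a b} → Tr (fn σ) (Tr (fn σ') E) a b → Tr τ E a b
  Tr-compose⇒ t = chain⇒visibleTrace (flatten c)
    (⊎ᶠ-undefined (VisibleTrace.visIn t) (start-undefined c))
    (⊎ᶠ-undefined (VisibleTrace.visOut t) (end-undefined σ c))
    where c = visibleTrace⇒chain t

  Tr-compose⇐ : ∀ {a b} → Tr τ E a b → Tr (fn σ) (Tr (fn σ') E) a b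
  Tr-compose⇐ t =
    chain⇒visibleTrace (close (expand (visibleTrace⇒chain t) (VisibleTrace.visOut t)) (proj₂ va))
      (proj₁ va) (proj₁ (⊎ᶠ-undefined⁻ (VisibleTrace.visOut t)))
    where va = ⊎ᶠ-undefined⁻ (VisibleTrace.visIn t)

lemma3p8 : (E : Edifice) (σ σ' : Feedback) → DisjointDom σ σ' →
    Tr (fn σ) (Tr (fn σ') E) ≐ Tr (fn σ ⊎ᶠ fn σ') E
lemma3p8 E σ σ' disjoint a b = map-⊎ Tr-compose⇒ Tr-compose⇒ , map-⊎ Tr-compose⇐ Tr-compose⇐
  where open Composition E σ σ' disjoint
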